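{- Let $G$ be a finite simple $r$-regular graph with $r\in\{2,3,4,5\}$. Then $G$ is of class one.
   Context: $\beta(G)$ is the size of a minimum vertex cover. Alcuin problem: the vertices of $G$ are items initially on the left bank of a river; a man with a boat of capacity $b$ (a positive integer) must carry them all to the right bank so that no two adjacent vertices are ever left together on a bank. Formally, a feasible schedule for capacity $b$ is a sequence of triples $(L_k,B_k,R_k)$, $k=1,\dots,s$, $s$ odd, such that: each triple is a partition of $V$; $L_k$ and $R_k$ are independent sets; $|B_k|\le b$; $L_1\cup B_1=V$; $B_s\cup R_s=V$; for even $k$, $L_k=L_{k-1}$ and $B_k\cup R_k=B_{k-1}\cup R_{k-1}$; for odd $k\ge 3$, $R_k=R_{k-1}$ and $B_k\cup L_k=B_{k-1}\cup L_{k-1}$. The Alcuin number $c(G)$ is the least positive integer $b$ for which a feasible schedule exists. One always has $\beta(G)\le c(G)\le \beta(G)+1$; $G$ is of class one if $c(G)=\beta(G)$ and of class two if $c(G)=\beta(G)+1$. -}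

module Defs where

open import Data.Nat using (ℕ; zero; suc; _+_; _*_; _≤_; _<_; _∸_)
open import Data.Bool using (Bool; true; false)
open import Data.Fin using (Fin)
open import Data.Fin.Subset using (Subset; _∈_; _∪_; _∩_; ⊥; ⊤; ∣_∣)
open import Data.Vec using (tabulate)
open import Data.Product using (Σ; _×_; ∃; ∃-syntax)
open import Data.Sum using (_⊎_)
open import Relation.Binary.PropositionalEquality using (_≡_)

record SimpleGraph (n : ℕ) : Set where
  field
    Adj   : Fin n → Fin n → Bool
    sym   : ∀ u v → Adj u v ≡ Adj v u
    irrefl : ∀ v → Adj v v ≡ false
open SimpleGraph public

N : ∀ {n} → SimpleGraph n → Fin n → Subset n
N G v = tabulate (Adj G v)

degree : ∀ {n} → SimpleGraph n → Fin n → ℕ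
degree G v = ∣ N G v ∣

Regular : ∀ {n} → ℕ → SimpleGraph n → Set
Regular {n} r G = ∀ (v : Fin n) → degree G v ≡ r

Independent : ∀ {n} → SimpleGraph n → Subset n → Set
Independent G S = ∀ u v → u ∈ S → v ∈ S → Adj G u v ≡ false

VertexCover : ∀ {n} → SimpleGraph n → Subset n → Set
VertexCover G C = ∀ u v → Adj G u v ≡ true → (u ∈ C) ⊎ (v ∈ C)

IsVertexCoverNumber : ∀ {n} → SimpleGraph n → ℕ → Set
IsVertexCoverNumber {n} G k =
  (Σ (Subset n) λ C → VertexCover G C × ∣ C ∣ ≡ k) ×
  (∀ (C : Subset n) → VertexCover G C → k ≤ ∣ C ∣)

record Triple (n : ℕ) : Set where
  constructor ⟨_,_,_⟩
  field
    L B R : Subset n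
open Triple public

IsPartition : ∀ {n} → Triple n → Set
IsPartition t =
  (L t ∩ B t ≡ ⊥) × (L t ∩ R t ≡ ⊥) × (B t ∩ R t ≡ ⊥) ×
  ((L t ∪ B t) ∪ R t ≡ ⊤)

-- A feasible schedule for capacity b: triples T 1, ..., T s (1-based; values of T
-- outside 1..s are irrelevant), s odd.
FeasibleSchedule : ∀ {n} → SimpleGraph n → ℕ → Set
FeasibleSchedule {n} G b =
  Σ ℕ λ m → Σ (ℕ → Triple n) λ T →
  let s = suc (2 * m) in
    (∀ k → 1 ≤ k → k ≤ s →
        IsPartition (T k) × Independent G (L (T k)) × Independent G (R (T k))
        × ∣ B (T k) ∣ ≤ b)
  × (L (T 1) ∪ B (T 1) ≡ ⊤)
  × (B (T s) ∪ R (T s) ≡ ⊤)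
  × (∀ j → 1 ≤ j → 2 * j ≤ s →
        (L (T (2 * j)) ≡ L (T (2 * j ∸ 1)))
      × (B (T (2 * j)) ∪ R (T (2 * j)) ≡ B (T (2 * j ∸ 1)) ∪ R (T (2 * j ∸ 1))))
  × (∀ j → 1 ≤ j → suc (2 * j) ≤ s →
        (R (T (suc (2 * j))) ≡ R (T (2 * j)))
      × (B (T (suc (2 * j))) ∪ L (T (suc (2 * j))) ≡ B (T (2 * j)) ∪ L (T (2 * j))))

IsAlcuinNumber : ∀ {n} → SimpleGraph n → ℕ → Set
IsAlcuinNumber G b =
  1 ≤ b × FeasibleSchedule G b × (∀ b′ → 1 ≤ b′ → FeasibleSchedule G b′ → b ≤ b′)

ClassOne : ∀ {n} → SimpleGraph n → Set
ClassOne G = ∃[ k ] (IsVertexCoverNumber G k × IsAlcuinNumber G k)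

-- Let X be a minimum vertex cover of G, I = V ∖ X (an independent set), and let Y₁, Y₂ ⊆ X be disjoint
-- independent sets with |Y₁| + |Y₂| maximum; put D = X ∖ (Y₁ ∪ Y₂). If |I| ≤ |Y₁| + |Y₂|, the man loads X,
-- crosses and leaves Y₁, returns and exchanges Y₂ for I, crosses and exchanges I for Y₁, returns to fetch Y₂
-- and crosses with X; the largest load is |I ∪ D| ≤ |X| = β(G). Since the first load of any schedule is a
-- vertex cover, c(G) = β(G).
-- For r-regular G, counting edges gives r|X| = r|I| + 2e(X). By maximality of (Y₁, Y₂) every vertex of D has
-- neighbours in both Y₁ and Y₂, and a vertex of D with exactly one neighbour in each and none in D can be
-- charged to an edge between Y₁ and Y₂, no two to the same edge. Hence 2e(X) ≥ 5|D|, so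
-- r|I| + 5|D| ≤ r(|Y₁| + |Y₂| + |D|), which gives |I| ≤ |Y₁| + |Y₂| as soon as r ≤ 5.

module Submission where

open import Defs hiding (sym)

open import Data.Bool using (Bool; true; false; _∧_; _∨_; not; T) renaming (_≟_ to _≟ᵇ_)
open import Data.Bool.Properties using (¬-not; ∨-comm; ∧-zeroʳ; ∧-identityʳ; ∧-distribˡ-∨; ∨-inverseˡ; not-involutive)
open import Data.Fin using (Fin; zero; suc; _≟_)
import Data.Fin.Properties as Fin
open import Data.Fin.Subset using (Subset; _∈_; _∉_; _∪_; _∩_; ⊥; ⊤; ∣_∣)
open import Data.Fin.Subset.Properties using (_∈?_; ∈⊤; x∈p∪q⁻; x∈p⇒∣p-x∣<∣p∣; ∣p∣≤n; anySubset?)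
open import Data.Nat using (ℕ; zero; suc; >-nonZero; _+_; _*_; _≤_; _<_; _∸_; _≡ᵇ_; z≤n; s≤s)
open import Data.Nat.Properties hiding (_≟_)
open import Data.Nat.Tactic.RingSolver using (solve-∀)
open import Algebra.Properties.Semiring.Sum +-*-semiring
  using (sum; sum-syntax; ∑-distrib-+; ∑-comm; *-distribˡ-sum; sum-cong-≗; sum-replicate-zero)
open import Data.Product using (∃; ∃₂; _×_; _,_; proj₁; proj₂)
open import Data.Sum using (_⊎_; inj₁; inj₂; [_,_])
open import Data.Vec using (tabulate; lookup; _∷_)
open import Data.Vec.Functional using (Vector)
open import Data.Vec.Properties using (lookup∘tabulate; tabulate∘lookup; tabulate-cong; lookup-replicate; []=⇒lookup)
open import Function using (_∘_)
open import Relation.Binary.PropositionalEquality hiding ([_])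
open import Relation.Nullary using (Dec; yes; no; contradiction)
open import Relation.Nullary.Decidable using (does; dec-true; dec-false; map′; _×-dec_; _→-dec_; _⊎-dec_)

private variable
  n : ℕ

⟦_⟧ : Bool → ℕ
⟦ true ⟧ = 1
⟦ false ⟧ = 0

count : Vector Bool n → ℕ
count {n} p = ∑[ u < n ] ⟦ p u ⟧

_⊆ᵇ_ : Vector Bool n → Vector Bool n → Set
p ⊆ᵇ q = ∀ u → p u ≡ true → q u ≡ true

Disjointᵇ : Vector Bool n → Vector Bool n → Set
Disjointᵇ p q = ∀ u → p u ≡ true → q u ≡ false

_∨̇_ : Vector Bool n → Vector Bool n → Vector Bool n
(p ∨̇ q) u = p u ∨ q u

｛_｝ : Fin n → Vector Bool n
｛ v ｝ u = does (u ≟ v)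

_∖｛_｝ : Vector Bool n → Fin n → Vector Bool n
(p ∖｛ v ｝) u = p u ∧ not (｛ v ｝ u)

∨̇-elim : (p q : Vector Bool n) → ∀ {u} → (p ∨̇ q) u ≡ true → p u ≡ true ⊎ q u ≡ true
∨̇-elim p q {u} pq with p u
... | true = inj₁ refl
... | false = inj₂ pq

weight-cong : ∀ α {m k} → (α ≡ true → m ≡ k) → ⟦ α ⟧ * m ≡ ⟦ α ⟧ * k
weight-cong false _ = refl
weight-cong true m≡k = cong (_+ 0) (m≡k refl)

weight-mono : ∀ α {m k} → (α ≡ true → m ≤ k) → ⟦ α ⟧ * m ≤ ⟦ α ⟧ * k
weight-mono false _ = z≤n
weight-mono true m≤k = +-monoˡ-≤ 0 (m≤k refl)

disjoint-sym : {p q : Vector Bool n} → Disjointᵇ p q → Disjointᵇ q p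
disjoint-sym disjoint u qu = ¬-not λ pu → contradiction (trans (sym (disjoint u pu)) qu) λ ()

∧-true : ∀ {α β} → α ∧ β ≡ true → α ≡ true × β ≡ true
∧-true {true} β≡true = refl , β≡true

≡ᵇ-true⇒≡ : ∀ {m k} → (m ≡ᵇ k) ≡ true → m ≡ k
≡ᵇ-true⇒≡ {m} {k} e = ≡ᵇ⇒≡ m k (subst T (sym e) _)

sum-mono-≤ : {f g : Vector ℕ n} → (∀ i → f i ≤ g i) → sum f ≤ sum g
sum-mono-≤ {zero} _ = z≤n
sum-mono-≤ {suc n} f≤g = +-mono-≤ (f≤g zero) (sum-mono-≤ (f≤g ∘ suc))

count-weighted : (p : Vector Bool n) (c : ℕ) → ∑[ v < n ] (⟦ p v ⟧ * c) ≡ c * count p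
count-weighted {n} p c = trans (sum-cong-≗ {n} λ v → *-comm ⟦ p v ⟧ c) (sym (*-distribˡ-sum {n} c _))

weighted-+ : (p : Vector Bool n) (f g : Vector ℕ n) →
  ∑[ v < n ] (⟦ p v ⟧ * (f v + g v)) ≡ ∑[ v < n ] (⟦ p v ⟧ * f v) + ∑[ v < n ] (⟦ p v ⟧ * g v)
weighted-+ {n} p f g = trans (sum-cong-≗ {n} λ v → *-distribˡ-+ ⟦ p v ⟧ (f v) (g v)) (∑-distrib-+ {n} _ _)

count-cong : {p q : Vector Bool n} → (∀ u → p u ≡ q u) → count p ≡ count q
count-cong p≗q = sum-cong-≗ (cong ⟦_⟧ ∘ p≗q)

count-mono : {p q : Vector Bool n} → p ⊆ᵇ q → count p ≤ count q
count-mono {p = p} {q} p⊆q = sum-mono-≤ λ u → ⟦⟧-mono (p u) (q u) (p⊆q u)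
  where
  ⟦⟧-mono : ∀ x y → (x ≡ true → y ≡ true) → ⟦ x ⟧ ≤ ⟦ y ⟧
  ⟦⟧-mono false y _ = z≤n
  ⟦⟧-mono true y x⇒y rewrite x⇒y refl = ≤-refl

⟦∨⟧ : ∀ α β → (α ≡ true → β ≡ false) → ⟦ α ∨ β ⟧ ≡ ⟦ α ⟧ + ⟦ β ⟧
⟦∨⟧ true β α⇒¬β rewrite α⇒¬β refl = refl
⟦∨⟧ false β _ = refl

count-∨̇ : {p q : Vector Bool n} → Disjointᵇ p q → count (p ∨̇ q) ≡ count p + count q
count-∨̇ {p = p} {q} disj = trans (sum-cong-≗ λ u → ⟦∨⟧ (p u) (q u) (disj u)) (∑-distrib-+ (⟦_⟧ ∘ p) (⟦_⟧ ∘ q))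

count-empty : {p : Vector Bool n} → (∀ u → p u ≡ false) → count p ≡ 0
count-empty {n} empty = trans (count-cong empty) (sum-replicate-zero n)

count-pos : (p : Vector Bool n) → ∀ {u} → p u ≡ true → 1 ≤ count p
count-pos p {zero} pu rewrite pu = s≤s z≤n
count-pos p {suc u} pu = ≤-trans (count-pos (p ∘ suc) pu) (m≤n+m _ ⟦ p zero ⟧)

unique⇒count≤1 : {p : Vector Bool n} → (∀ u w → p u ≡ true → p w ≡ true → u ≡ w) → count p ≤ 1
unique⇒count≤1 {zero} _ = z≤n
unique⇒count≤1 {suc n} {p} unique with p zero in p0
... | false = unique⇒count≤1 λ u w pu pw → Fin.suc-injective (unique (suc u) (suc w) pu pw)
... | true = s≤s (≤-reflexive (count-empty λ u → ¬-not λ pu → Fin.0≢1+n (unique zero (suc u) p0 pu)))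

count-witness : {p : Vector Bool n} → 1 ≤ count p → ∃ λ u → p u ≡ true
count-witness {p = p} 1≤count with Fin.any? (λ u → p u ≟ᵇ true)
... | yes witness = witness
... | no none = contradiction (count-empty λ u → ¬-not λ pu → none (u , pu)) (m<n⇒n≢0 1≤count)

｛｝-sound : ∀ {v u : Fin n} → ｛ v ｝ u ≡ true → u ≡ v
｛｝-sound {v = v} {u} _ with u ≟ v
... | yes u≡v = u≡v

｛｝-self : (v : Fin n) → ｛ v ｝ v ≡ true
｛｝-self v = dec-true (v ≟ v) refl

count-｛｝ : (v : Fin n) → count ｛ v ｝ ≡ 1
count-｛｝ v = ≤-antisym
  (unique⇒count≤1 {p = ｛ v ｝} λ u w vu vw → trans (｛｝-sound vu) (sym (｛｝-sound vw)))
  (count-pos ｛ v ｝ {v} (｛｝-self v))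

｛｝-disjoint : {p : Vector Bool n} → ∀ {v} → p v ≡ false → Disjointᵇ p ｛ v ｝
｛｝-disjoint {p = p} {v} pv u pu = dec-false (u ≟ v) λ { refl → contradiction (trans (sym pu) pv) λ () }

count-insert : (p : Vector Bool n) → ∀ {v} → p v ≡ false → count (p ∨̇ ｛ v ｝) ≡ suc (count p)
count-insert p {v} pv = begin
  count (p ∨̇ ｛ v ｝)      ≡⟨ count-∨̇ (｛｝-disjoint {p = p} pv) ⟩
  count p + count ｛ v ｝  ≡⟨ cong (count p +_) (count-｛｝ v) ⟩
  count p + 1             ≡⟨ +-comm (count p) 1 ⟩
  suc (count p)           ∎
  where open ≡-Reasoning

∖｛｝-⊆ : (p : Vector Bool n) (v : Fin n) → (p ∖｛ v ｝) ⊆ᵇ p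
∖｛｝-⊆ p v u pu∧ with p u
... | true = refl

∖｛｝-self : (p : Vector Bool n) (v : Fin n) → (p ∖｛ v ｝) v ≡ false
∖｛｝-self p v = trans (cong (λ s → p v ∧ not s) (｛｝-self v)) (∧-zeroʳ (p v))

∖｛｝-other : (p : Vector Bool n) (v : Fin n) → ∀ {u} → (p ∖｛ v ｝) u ≡ true → u ≢ v
∖｛｝-other p v pu∧ u≡v =
  contradiction (trans (sym (∖｛｝-self p v)) (subst (λ w → (p ∖｛ v ｝) w ≡ true) u≡v pu∧)) λ ()

∖｛｝-outside : (p : Vector Bool n) → ∀ {u v} → p u ≡ false → (p ∖｛ v ｝) u ≡ false
∖｛｝-outside p pu rewrite pu = refl

∨̇｛｝-outside : (p : Vector Bool n) → ∀ {u v} → p u ≡ false → u ≢ v → (p ∨̇ ｛ v ｝) u ≡ false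
∨̇｛｝-outside p {u} {v} pu u≢v rewrite pu = dec-false (u ≟ v) u≢v

count-delete : (p : Vector Bool n) → ∀ {v} → p v ≡ true → count p ≡ suc (count (p ∖｛ v ｝))
count-delete p {v} pv = begin
  count p
    ≡⟨ count-cong (λ u → split (p u) (｛ v ｝ u) λ vu → subst (λ w → p w ≡ true) (sym (｛｝-sound vu)) pv) ⟩
  count ((p ∖｛ v ｝) ∨̇ ｛ v ｝)     ≡⟨ count-insert (p ∖｛ v ｝) (∖｛｝-self p v) ⟩
  suc (count (p ∖｛ v ｝))          ∎
  where
  open ≡-Reasoning
  split : ∀ x s → (s ≡ true → x ≡ true) → x ≡ (x ∧ not s) ∨ s
  split false false _ = refl
  split true false _ = refl
  split false true s⇒x = s⇒x refl
  split true true _ = refl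

count-replace : (p : Vector Bool n) → ∀ {a v} → p a ≡ true → p v ≡ false →
  count ((p ∖｛ a ｝) ∨̇ ｛ v ｝) ≡ count p
count-replace p {a} pa pv = trans (count-insert (p ∖｛ a ｝) (∖｛｝-outside p pv)) (sym (count-delete p pa))

count≤1⇒unique : {p : Vector Bool n} → count p ≤ 1 → ∀ {u w} → p u ≡ true → p w ≡ true → u ≡ w
count≤1⇒unique {p = p} count≤1 {u} {w} pu pw with u ≟ w
... | yes u≡w = u≡w
... | no u≢w = contradiction (≤-trans two≤count count≤1) (<⇒≱ ≤-refl)
  where
  pair⊆p : (｛ u ｝ ∨̇ ｛ w ｝) ⊆ᵇ p
  pair⊆p z z∈pair with does (z ≟ u) in z≟u
  ... | true = subst (λ y → p y ≡ true) (sym (｛｝-sound {v = u} z≟u)) pu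
  ... | false = subst (λ y → p y ≡ true) (sym (｛｝-sound {v = w} z∈pair)) pw
  two≤count : 2 ≤ count p
  two≤count = begin
    2                              ≡⟨ cong₂ _+_ (count-｛｝ u) (count-｛｝ w) ⟨
    count ｛ u ｝ + count ｛ w ｝
      ≡⟨ count-∨̇ (λ z zu → dec-false (z ≟ w) λ z≡w → u≢w (trans (sym (｛｝-sound {v = u} zu)) z≡w)) ⟨
    count (｛ u ｝ ∨̇ ｛ w ｝)        ≤⟨ count-mono pair⊆p ⟩
    count p                        ∎
    where open ≤-Reasoning

∣tabulate∣ : (p : Vector Bool n) → ∣ tabulate p ∣ ≡ count p
∣tabulate∣ {zero} p = refl
∣tabulate∣ {suc n} p with p zero
... | true = cong suc (∣tabulate∣ (p ∘ suc))
... | false = ∣tabulate∣ (p ∘ suc)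

∣∣≡count-lookup : (X : Subset n) → ∣ X ∣ ≡ count (lookup X)
∣∣≡count-lookup X = trans (cong ∣_∣ (sym (tabulate∘lookup X))) (∣tabulate∣ (lookup X))

∈⇒lookup : ∀ {X : Subset n} {u} → u ∈ X → lookup X u ≡ true
∈⇒lookup = []=⇒lookup

∈-tabulate⁻ : ∀ {p : Vector Bool n} {u} → u ∈ tabulate p → p u ≡ true
∈-tabulate⁻ {p = p} {u} u∈p = trans (sym (lookup∘tabulate p u)) (∈⇒lookup u∈p)

tabulate-∪ : (p q : Vector Bool n) → tabulate p ∪ tabulate q ≡ tabulate (p ∨̇ q)
tabulate-∪ {zero} p q = refl
tabulate-∪ {suc n} p q = cong ((p zero ∨ q zero) ∷_) (tabulate-∪ (p ∘ suc) (q ∘ suc))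

tabulate-∩ : (p q : Vector Bool n) → tabulate p ∩ tabulate q ≡ tabulate (λ u → p u ∧ q u)
tabulate-∩ {zero} p q = refl
tabulate-∩ {suc n} p q = cong ((p zero ∧ q zero) ∷_) (tabulate-∩ (p ∘ suc) (q ∘ suc))

⊥≡tabulate : ⊥ ≡ tabulate {n} (λ _ → false)
⊥≡tabulate {zero} = refl
⊥≡tabulate {suc n} = cong (false ∷_) ⊥≡tabulate

⊤≡tabulate : ⊤ ≡ tabulate {n} (λ _ → true)
⊤≡tabulate {zero} = refl
⊤≡tabulate {suc n} = cong (true ∷_) ⊤≡tabulate

Searchable : Set → Set₁
Searchable A = ∀ {P : A → Set} → (∀ a → Dec (P a)) → Dec (∃ P)

×-searchable : ∀ {A B : Set} → Searchable A → Searchable B → Searchable (A × B)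
×-searchable search-A search-B P? with search-A (λ a → search-B (λ b → P? (a , b)))
... | yes (a , b , pab) = yes ((a , b) , pab)
... | no ∄ = no λ { ((a , b) , pab) → ∄ (a , b , pab) }

module _ {A : Set} (search : Searchable A) {P : A → Set} (P? : ∀ a → Dec (P a)) (μ : A → ℕ) where

  maximum-exists : ∀ M → (∀ a → P a → μ a ≤ M) → ∃ P → ∃ λ a → P a × (∀ b → P b → μ b ≤ μ a)
  maximum-exists M bounded (a₀ , pa₀) with search (λ a → P? a ×-dec (M ≤? μ a))
  ... | yes (a , pa , M≤μa) = a , pa , λ b pb → ≤-trans (bounded b pb) M≤μa
  maximum-exists zero bounded (a₀ , pa₀) | no ∄ = contradiction (a₀ , pa₀ , z≤n) ∄
  maximum-exists (suc M) bounded (a₀ , pa₀) | no ∄ =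
    maximum-exists M (λ a pa → ≤-pred (≰⇒> λ M≤μa → ∄ (a , pa , M≤μa))) (a₀ , pa₀)

  minimum-exists : ∃ P → ∃ λ a → P a × (∀ b → P b → μ a ≤ μ b)
  minimum-exists (a₀ , pa₀) = descend (μ a₀) a₀ pa₀ ≤-refl
    where
    descend : ∀ k a → P a → μ a ≤ k → ∃ λ a → P a × (∀ b → P b → μ a ≤ μ b)
    descend k a pa μa≤k with search (λ b → P? b ×-dec (μ b <? μ a))
    ... | no ∄ = a , pa , λ b pb → ≮⇒≥ λ μb<μa → ∄ (b , pb , μb<μa)
    ... | yes (b , pb , μb<μa) with k
    ...   | zero = contradiction (≤-trans μb<μa μa≤k) λ ()
    ...   | suc k = descend k b pb (≤-pred (≤-trans μb<μa μa≤k))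

module _ (G : SimpleGraph n) where

  IndependentSet : Vector Bool n → Set
  IndependentSet p = ∀ u v → p u ≡ true → p v ≡ true → Adj G u v ≡ false

  independent-tabulate : {p : Vector Bool n} → IndependentSet p → Independent G (tabulate p)
  independent-tabulate p-indep u v u∈p v∈p = p-indep u v (∈-tabulate⁻ u∈p) (∈-tabulate⁻ v∈p)

  independent-insert : {p : Vector Bool n} → ∀ {v} → IndependentSet p →
    (∀ u → p u ≡ true → Adj G v u ≡ false) → IndependentSet (p ∨̇ ｛ v ｝)
  independent-insert {p = p} {v} p-indep v-isolated u w u∈ w∈
    with ∨̇-elim p ｛ v ｝ u∈ | ∨̇-elim p ｛ v ｝ w∈
  ... | inj₁ pu | inj₁ pw = p-indep u w pu pw
  ... | inj₁ pu | inj₂ w=v with refl ← ｛｝-sound {v = v} {w} w=v = trans (SimpleGraph.sym G u v) (v-isolated u pu)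
  ... | inj₂ u=v | inj₁ pw with refl ← ｛｝-sound {v = v} {u} u=v = v-isolated w pw
  ... | inj₂ u=v | inj₂ w=v with refl ← ｛｝-sound {v = v} {u} u=v | refl ← ｛｝-sound {v = v} {w} w=v = SimpleGraph.irrefl G v

  degreeIn : Vector Bool n → Fin n → ℕ
  degreeIn q v = count (λ u → Adj G v u ∧ q u)

  edges : Vector Bool n → Vector Bool n → ℕ
  edges p q = ∑[ v < n ] (⟦ p v ⟧ * degreeIn q v)

  edges-sym : (p q : Vector Bool n) → edges p q ≡ edges q p
  edges-sym p q = begin
    ∑[ v < n ] (⟦ p v ⟧ * degreeIn q v)                     ≡⟨ sum-cong-≗ {n} (λ v → *-distribˡ-sum {n} ⟦ p v ⟧ _) ⟩
    ∑[ v < n ] ∑[ u < n ] (⟦ p v ⟧ * ⟦ Adj G v u ∧ q u ⟧)   ≡⟨ ∑-comm {n} {n} _ ⟩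
    ∑[ u < n ] ∑[ v < n ] (⟦ p v ⟧ * ⟦ Adj G v u ∧ q u ⟧)
      ≡⟨ sum-cong-≗ {n} (λ u → sum-cong-≗ {n} λ v → swap-ends (p v) (q u) (SimpleGraph.sym G v u)) ⟩
    ∑[ u < n ] ∑[ v < n ] (⟦ q u ⟧ * ⟦ Adj G u v ∧ p v ⟧)   ≡⟨ sum-cong-≗ {n} (λ u → *-distribˡ-sum {n} ⟦ q u ⟧ _) ⟨
    ∑[ u < n ] (⟦ q u ⟧ * degreeIn p u)                     ∎
    where
    open ≡-Reasoning
    swap-ends : ∀ α β {e e′} → e ≡ e′ → ⟦ α ⟧ * ⟦ e ∧ β ⟧ ≡ ⟦ β ⟧ * ⟦ e′ ∧ α ⟧
    swap-ends true true refl = refl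
    swap-ends true false {false} refl = refl
    swap-ends true false {true} refl = refl
    swap-ends false true {false} refl = refl
    swap-ends false true {true} refl = refl
    swap-ends false false refl = refl

  degreeIn-partition : {q q₁ q₂ : Vector Bool n} → (∀ u → q u ≡ q₁ u ∨ q₂ u) → Disjointᵇ q₁ q₂ →
    ∀ v → degreeIn q v ≡ degreeIn q₁ v + degreeIn q₂ v
  degreeIn-partition {q} {q₁} {q₂} q≡q₁∨q₂ disjoint v =
    trans (count-cong λ u → trans (cong (Adj G v u ∧_) (q≡q₁∨q₂ u)) (∧-distribˡ-∨ (Adj G v u) (q₁ u) (q₂ u)))
          (count-∨̇ λ u → restrict (Adj G v u) (q₁ u) (q₂ u) (disjoint u))
    where
    restrict : ∀ e β γ → (β ≡ true → γ ≡ false) → e ∧ β ≡ true → e ∧ γ ≡ false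
    restrict true true γ β⇒¬γ _ = β⇒¬γ refl

  degree-split : (p : Vector Bool n) → ∀ v → degree G v ≡ degreeIn (not ∘ p) v + degreeIn p v
  degree-split p v = begin
    degree G v                           ≡⟨ ∣tabulate∣ (Adj G v) ⟩
    count (Adj G v)                      ≡⟨ count-cong {n} (λ u → ∧-identityʳ _) ⟨
    degreeIn (λ _ → true) v
      ≡⟨ degreeIn-partition (λ u → sym (∨-inverseˡ (p u))) (λ u ¬pu → trans (sym (not-involutive (p u))) (cong not ¬pu)) v ⟩
    degreeIn (not ∘ p) v + degreeIn p v  ∎
    where open ≡-Reasoning

  edges-const : {p q : Vector Bool n} {c : ℕ} → (∀ v → p v ≡ true → degreeIn q v ≡ c) → edges p q ≡ c * count p
  edges-const {p} {q} {c} const = begin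
    ∑[ v < n ] (⟦ p v ⟧ * degreeIn q v)  ≡⟨ sum-cong-≗ {n} (λ v → weight-cong (p v) (const v)) ⟩
    ∑[ v < n ] (⟦ p v ⟧ * c)             ≡⟨ count-weighted p c ⟩
    c * count p                         ∎
    where open ≡-Reasoning

  edges-partitionˡ : {p q q′ : Vector Bool n} → (∀ v → p v ≡ q v ∨ q′ v) → Disjointᵇ q q′ →
    (r : Vector Bool n) → edges p r ≡ edges q r + edges q′ r
  edges-partitionˡ {p} {q} {q′} p≡q∨q′ disjoint r = begin
    ∑[ v < n ] (⟦ p v ⟧ * degreeIn r v)
      ≡⟨ sum-cong-≗ {n} (λ v → cong (λ α → ⟦ α ⟧ * degreeIn r v) (p≡q∨q′ v)) ⟩
    ∑[ v < n ] (⟦ q v ∨ q′ v ⟧ * degreeIn r v)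
      ≡⟨ sum-cong-≗ {n} (λ v → cong (_* degreeIn r v) (⟦∨⟧ (q v) (q′ v) (disjoint v))) ⟩
    ∑[ v < n ] ((⟦ q v ⟧ + ⟦ q′ v ⟧) * degreeIn r v)
      ≡⟨ sum-cong-≗ {n} (λ v → *-distribʳ-+ (degreeIn r v) ⟦ q v ⟧ ⟦ q′ v ⟧) ⟩
    ∑[ v < n ] (⟦ q v ⟧ * degreeIn r v + ⟦ q′ v ⟧ * degreeIn r v)    ≡⟨ ∑-distrib-+ {n} _ _ ⟩
    edges q r + edges q′ r                                           ∎
    where open ≡-Reasoning

  edges-partitionʳ : {q q₁ q₂ : Vector Bool n} → (∀ u → q u ≡ q₁ u ∨ q₂ u) → Disjointᵇ q₁ q₂ →
    (p : Vector Bool n) → edges p q ≡ edges p q₁ + edges p q₂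
  edges-partitionʳ q≡q₁∨q₂ disjoint p =
    trans (sum-cong-≗ {n} λ v → cong (⟦ p v ⟧ *_) (degreeIn-partition q≡q₁∨q₂ disjoint v)) (weighted-+ p _ _)

  edges-mono : {p q q′ : Vector Bool n} → (∀ v → p v ≡ true → degreeIn q v ≤ degreeIn q′ v) → edges p q ≤ edges p q′
  edges-mono {p} mono = sum-mono-≤ λ v → weight-mono (p v) (mono v)

  edges-regular : ∀ {r} → Regular r G → (p q : Vector Bool n) → edges p (not ∘ q) + edges p q ≡ r * count p
  edges-regular {r} regular p q = begin
    edges p (not ∘ q) + edges p q                                 ≡⟨ weighted-+ p _ _ ⟨
    ∑[ v < n ] (⟦ p v ⟧ * (degreeIn (not ∘ q) v + degreeIn q v))
      ≡⟨ sum-cong-≗ {n} (λ v → cong (⟦ p v ⟧ *_) (trans (sym (degree-split q v)) (regular v))) ⟩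
    ∑[ v < n ] (⟦ p v ⟧ * r)                                       ≡⟨ count-weighted p r ⟩
    r * count p                                                   ∎
    where open ≡-Reasoning

  cover⇒independent-complement : {X : Subset n} → VertexCover G X → IndependentSet (not ∘ lookup X)
  cover⇒independent-complement {X} cover u v u∉X v∉X = ¬-not λ edge → [ outside u∉X , outside v∉X ] (cover u v edge)
    where
    outside : ∀ {w} → not (lookup X w) ≡ true → w ∉ X
    outside w∉X w∈X = contradiction (trans (sym (cong not (∈⇒lookup w∈X))) w∉X) λ ()

  first-load-covers : ∀ {b} → FeasibleSchedule G b → ∃ λ C → VertexCover G C × ∣ C ∣ ≤ b
  first-load-covers (_ , T , stage , first-bank , _) = B (T 1) , cover , capacity
    where
    L-independent : Independent G (L (T 1))
    L-independent = proj₁ (proj₂ (stage 1 (s≤s z≤n) (s≤s z≤n)))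
    capacity = proj₂ (proj₂ (proj₂ (stage 1 (s≤s z≤n) (s≤s z≤n))))
    left-or-boat : ∀ u → u ∈ L (T 1) ⊎ u ∈ B (T 1)
    left-or-boat u = x∈p∪q⁻ (L (T 1)) (B (T 1)) (subst (u ∈_) (sym first-bank) ∈⊤)
    cover : VertexCover G (B (T 1))
    cover u v edge with u ∈? B (T 1) | v ∈? B (T 1)
    ... | yes u∈B | _ = inj₁ u∈B
    ... | no _ | yes v∈B = inj₂ v∈B
    ... | no u∉B | no v∉B = contradiction (trans (sym edge) (L-independent u v (on-left u∉B) (on-left v∉B))) λ ()
      where
      on-left : ∀ {w} → w ∉ B (T 1) → w ∈ L (T 1)
      on-left {w} w∉B = [ (λ w∈L → w∈L) , (λ w∈B → contradiction w∈B w∉B) ] (left-or-boat w)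

  cover-nonempty : {C : Subset n} → VertexCover G C → ∀ {u v} → Adj G u v ≡ true → 1 ≤ ∣ C ∣
  cover-nonempty {C} cover {u} {v} edge = [ nonempty , nonempty ] (cover u v edge)
    where
    nonempty : ∀ {w} → w ∈ C → 1 ≤ ∣ C ∣
    nonempty w∈C = ≤-trans (s≤s z≤n) (x∈p⇒∣p-x∣<∣p∣ w∈C)

  independent⇒degreeIn≡0 : ∀ {p} → IndependentSet p → ∀ {v} → p v ≡ true → degreeIn p v ≡ 0
  independent⇒degreeIn≡0 {p} p-indep {v} pv = count-empty nonadjacent
    where
    nonadjacent : ∀ u → Adj G v u ∧ p u ≡ false
    nonadjacent u with p u in pu
    ... | true = trans (∧-identityʳ _) (p-indep v u pv pu)
    ... | false = ∧-zeroʳ _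

  no-neighbour : ∀ {q v} → degreeIn q v < 1 → ∀ u → q u ≡ true → Adj G v u ≡ false
  no-neighbour {q} {v} degree<1 u qu =
    ¬-not λ edge → <⇒≱ degree<1 (count-pos (λ w → Adj G v w ∧ q w) {u} (cong₂ _∧_ edge qu))

  neighbour-exists : ∀ {v} → 1 ≤ degree G v → ∃ λ u → Adj G v u ≡ true
  neighbour-exists {v} 1≤degree = count-witness {p = Adj G v} (subst (1 ≤_) (∣tabulate∣ (Adj G v)) 1≤degree)

  vertexCover? : (C : Subset n) → Dec (VertexCover G C)
  vertexCover? C = Fin.all? λ u → Fin.all? λ v → (Adj G u v ≟ᵇ true) →-dec ((u ∈? C) ⊎-dec (v ∈? C))

  record IndependentPairIn (x y₁ y₂ : Vector Bool n) : Set where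
    field
      independent₁ : IndependentSet y₁
      independent₂ : IndependentSet y₂
      inside₁ : y₁ ⊆ᵇ x
      inside₂ : y₂ ⊆ᵇ x
      disjoint : Disjointᵇ y₁ y₂

  module _ (x : Vector Bool n) where

    independentPair? : (y₁ y₂ : Vector Bool n) → Dec (IndependentPairIn x y₁ y₂)
    independentPair? y₁ y₂ = map′
      (λ (i₁ , i₂ , s₁ , s₂ , d) →
        record { independent₁ = i₁ ; independent₂ = i₂ ; inside₁ = s₁ ; inside₂ = s₂ ; disjoint = d })
      (λ pair → let open IndependentPairIn pair in independent₁ , independent₂ , inside₁ , inside₂ , disjoint)
      (independent? y₁ ×-dec independent? y₂ ×-dec ⊆? y₁ ×-dec ⊆? y₂ ×-dec disjoint?)
      where
      independent? : (p : Vector Bool n) → Dec (IndependentSet p)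
      independent? p = Fin.all? λ u → Fin.all? λ v → (p u ≟ᵇ true) →-dec ((p v ≟ᵇ true) →-dec (Adj G u v ≟ᵇ false))
      ⊆? : (p : Vector Bool n) → Dec (p ⊆ᵇ x)
      ⊆? p = Fin.all? λ u → (p u ≟ᵇ true) →-dec (x u ≟ᵇ true)
      disjoint? : Dec (Disjointᵇ y₁ y₂)
      disjoint? = Fin.all? λ u → (y₁ u ≟ᵇ true) →-dec (y₂ u ≟ᵇ false)

    swap-pair : ∀ {y₁ y₂} → IndependentPairIn x y₁ y₂ → IndependentPairIn x y₂ y₁
    swap-pair pair = record
      { independent₁ = independent₂ ; independent₂ = independent₁
      ; inside₁ = inside₂ ; inside₂ = inside₁ ; disjoint = disjoint-sym disjoint }
      where open IndependentPairIn pair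

    shrink₁ : ∀ {y₁ y₂ z} → z ⊆ᵇ y₁ → IndependentPairIn x y₁ y₂ → IndependentPairIn x z y₂
    shrink₁ z⊆y₁ pair = record
      { independent₁ = λ u v zu zv → independent₁ u v (z⊆y₁ u zu) (z⊆y₁ v zv)
      ; independent₂ = independent₂
      ; inside₁ = λ u zu → inside₁ u (z⊆y₁ u zu)
      ; inside₂ = inside₂
      ; disjoint = λ u zu → disjoint u (z⊆y₁ u zu) }
      where open IndependentPairIn pair

    insert₁ : ∀ {y₁ y₂ v} → IndependentPairIn x y₁ y₂ → x v ≡ true → y₂ v ≡ false →
      (∀ u → y₁ u ≡ true → Adj G v u ≡ false) → IndependentPairIn x (y₁ ∨̇ ｛ v ｝) y₂
    insert₁ {y₁} {y₂} {v} pair xv ¬y₂v v-isolated = record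
      { independent₁ = independent-insert independent₁ v-isolated
      ; independent₂ = independent₂
      ; inside₁ = λ u u∈ → [ inside₁ u , (λ u=v → subst (λ w → x w ≡ true) (sym (｛｝-sound {v = v} {u} u=v)) xv) ]
                             (∨̇-elim y₁ ｛ v ｝ u∈)
      ; inside₂ = inside₂
      ; disjoint = λ u u∈ → [ disjoint u , (λ u=v → subst (λ w → y₂ w ≡ false) (sym (｛｝-sound {v = v} {u} u=v)) ¬y₂v) ]
                             (∨̇-elim y₁ ｛ v ｝ u∈) }
      where open IndependentPairIn pair

    empty-pair : IndependentPairIn x (lookup (⊥ {n})) (lookup ⊥)
    empty-pair = record
      { independent₁ = λ u _ u∈⊥ → absurd u∈⊥ ; independent₂ = λ u _ u∈⊥ → absurd u∈⊥
      ; inside₁ = λ _ u∈⊥ → absurd u∈⊥ ; inside₂ = λ _ u∈⊥ → absurd u∈⊥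
      ; disjoint = λ u _ → lookup-replicate u false }
      where
      absurd : ∀ {A : Set} {u} → lookup (⊥ {n}) u ≡ true → A
      absurd {u = u} u∈⊥ = contradiction (trans (sym (lookup-replicate u false)) u∈⊥) λ ()

    record IsMaximumPairIn (y₁ y₂ : Vector Bool n) : Set where
      field
        pair : IndependentPairIn x y₁ y₂
        maximal : ∀ {z₁ z₂} → IndependentPairIn x z₁ z₂ → count z₁ + count z₂ ≤ count y₁ + count y₂

    swap-maximum : ∀ {y₁ y₂} → IsMaximumPairIn y₁ y₂ → IsMaximumPairIn y₂ y₁
    swap-maximum {y₁} {y₂} max = record
      { pair = swap-pair pair
      ; maximal = λ {z₁} {z₂} pair′ →
          subst₂ _≤_ (+-comm (count z₂) (count z₁)) (+-comm (count y₁) (count y₂)) (maximal (swap-pair pair′)) }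
      where open IsMaximumPairIn max

    -- Pairs are searched for among subsets, where exhaustive search is available; maximality then
    -- transfers to all Boolean vectors along tabulate.
    maximum-pair-exists : ∃₂ IsMaximumPairIn
    maximum-pair-exists with maximum-exists (×-searchable anySubset? anySubset?)
                               (λ (Y₁ , Y₂) → independentPair? (lookup Y₁) (lookup Y₂))
                               (λ (Y₁ , Y₂) → ∣ Y₁ ∣ + ∣ Y₂ ∣) (n + n)
                               (λ (Y₁ , Y₂) _ → +-mono-≤ (∣p∣≤n Y₁) (∣p∣≤n Y₂))
                               ((⊥ , ⊥) , empty-pair)
    ... | (Y₁ , Y₂) , pair , max = lookup Y₁ , lookup Y₂ , record { pair = pair ; maximal = maximal }
      where
      maximal : ∀ {z₁ z₂} → IndependentPairIn x z₁ z₂ → count z₁ + count z₂ ≤ count (lookup Y₁) + count (lookup Y₂)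
      maximal {z₁} {z₂} pair′ = begin
        count z₁ + count z₂                       ≡⟨ cong₂ _+_ (∣tabulate∣ z₁) (∣tabulate∣ z₂) ⟨
        ∣ tabulate z₁ ∣ + ∣ tabulate z₂ ∣
          ≤⟨ max (tabulate z₁ , tabulate z₂) (swap-pair (shrink₁ (tabulated z₂) (swap-pair (shrink₁ (tabulated z₁) pair′)))) ⟩
        ∣ Y₁ ∣ + ∣ Y₂ ∣                           ≡⟨ cong₂ _+_ (∣∣≡count-lookup Y₁) (∣∣≡count-lookup Y₂) ⟩
        count (lookup Y₁) + count (lookup Y₂)     ∎
        where
        open ≤-Reasoning
        tabulated : (z : Vector Bool n) → lookup (tabulate z) ⊆ᵇ z
        tabulated z u = trans (sym (lookup∘tabulate z u))

-- The five-trip schedule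

data Part : Set where
  I Y₁ Y₂ D : Part

every-part : {P : Part → Set} → P I → P Y₁ → P Y₂ → P D → ∀ p → P p
every-part i _ _ _ I = i
every-part _ y₁ _ _ Y₁ = y₁
every-part _ _ y₂ _ Y₂ = y₂
every-part _ _ _ d D = d

is : Part → Part → Bool
is I I = true
is Y₁ Y₁ = true
is Y₂ Y₂ = true
is D D = true
is _ _ = false

_∪ᴾ_ : (Part → Bool) → (Part → Bool) → Part → Bool
(S ∪ᴾ S′) p = S p ∨ S′ p

nothing : Part → Bool
nothing _ = false

exactly-one : Bool → Bool → Bool → Bool
exactly-one true false false = true
exactly-one false true false = true
exactly-one false false true = true
exactly-one _ _ _ = false

exactly-one-spec : ∀ {α β γ} → exactly-one α β γ ≡ true →
  α ∧ β ≡ false × α ∧ γ ≡ false × β ∧ γ ≡ false × (α ∨ β) ∨ γ ≡ true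
exactly-one-spec {true} {false} {false} _ = refl , refl , refl , refl
exactly-one-spec {false} {true} {false} _ = refl , refl , refl , refl
exactly-one-spec {false} {false} {true} _ = refl , refl , refl , refl

classify : Bool → Bool → Bool → Part
classify true _ _ = Y₁
classify false true _ = Y₂
classify false false true = D
classify false false false = I

module Schedule {G : SimpleGraph n} {x y₁ y₂ : Vector Bool n}
  (outside-independent : IndependentSet G (not ∘ x)) (pair : IndependentPairIn G x y₁ y₂)
  (outside≤pair : count (not ∘ x) ≤ count y₁ + count y₂) where

  open IndependentPairIn pair

  part : Fin n → Part
  part u = classify (y₁ u) (y₂ u) (x u)

  part-Y₁ : ∀ u → y₁ u ≡ is Y₁ (part u)
  part-Y₁ u = go (y₁ u) (y₂ u) (x u)
    where
    go : ∀ α β ξ → α ≡ is Y₁ (classify α β ξ)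
    go true _ _ = refl
    go false true _ = refl
    go false false true = refl
    go false false false = refl

  part-Y₂ : ∀ u → y₂ u ≡ is Y₂ (part u)
  part-Y₂ u = go (y₁ u) (y₂ u) (x u) (disjoint u)
    where
    go : ∀ α β ξ → (α ≡ true → β ≡ false) → β ≡ is Y₂ (classify α β ξ)
    go true β _ α⇒¬β = α⇒¬β refl
    go false true _ _ = refl
    go false false true _ = refl
    go false false false _ = refl

  part-I : ∀ u → not (x u) ≡ is I (part u)
  part-I u = go (y₁ u) (y₂ u) (x u) (inside₁ u) (inside₂ u)
    where
    go : ∀ α β ξ → (α ≡ true → ξ ≡ true) → (β ≡ true → ξ ≡ true) → not ξ ≡ is I (classify α β ξ)
    go true _ _ α⇒ξ _ = cong not (α⇒ξ refl)
    go false true _ _ β⇒ξ = cong not (β⇒ξ refl)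
    go false false true _ _ = refl
    go false false false _ _ = refl

  -- Opaque, so that Agda can read off S from ⟪ S ⟫ when checking the stages below.
  opaque
    ⟪_⟫ : (Part → Bool) → Subset n
    ⟪ S ⟫ = tabulate (S ∘ part)

    ∣⟪⟫∣ : ∀ S → ∣ ⟪ S ⟫ ∣ ≡ count (S ∘ part)
    ∣⟪⟫∣ S = ∣tabulate∣ (S ∘ part)

    ⟪⟫-∪ᴾ : ∀ {S S′} → ⟪ S ⟫ ∪ ⟪ S′ ⟫ ≡ ⟪ S ∪ᴾ S′ ⟫
    ⟪⟫-∪ᴾ = tabulate-∪ _ _

    ⟪⟫-∪ : ∀ {S S′ T T′} → (∀ p → (S ∪ᴾ S′) p ≡ (T ∪ᴾ T′) p) → ⟪ S ⟫ ∪ ⟪ S′ ⟫ ≡ ⟪ T ⟫ ∪ ⟪ T′ ⟫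
    ⟪⟫-∪ same = trans (tabulate-∪ _ _) (trans (tabulate-cong (same ∘ part)) (sym (tabulate-∪ _ _)))

    ⟪⟫-∪-⊤ : ∀ {S S′} → (∀ p → (S ∪ᴾ S′) p ≡ true) → ⟪ S ⟫ ∪ ⟪ S′ ⟫ ≡ ⊤
    ⟪⟫-∪-⊤ all = trans (tabulate-∪ _ _) (trans (tabulate-cong (all ∘ part)) (sym ⊤≡tabulate))

    ⟪⟫-∩-⊥ : ∀ {S S′} → (∀ p → S p ∧ S′ p ≡ false) → ⟪ S ⟫ ∩ ⟪ S′ ⟫ ≡ ⊥
    ⟪⟫-∩-⊥ none = trans (tabulate-∩ _ _) (trans (tabulate-cong (none ∘ part)) (sym ⊥≡tabulate))

    ⟪⟫-independent : ∀ {S q} → IndependentSet G q → (∀ u → S (part u) ≡ true → q u ≡ true) → Independent G ⟪ S ⟫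
    ⟪⟫-independent q-independent S⊆q =
      independent-tabulate G λ u v su sv → q-independent u v (S⊆q u su) (S⊆q v sv)

  stage : (Part → Bool) → (Part → Bool) → (Part → Bool) → Triple n
  stage S₁ S₂ S₃ = ⟨ ⟪ S₁ ⟫ , ⟪ S₂ ⟫ , ⟪ S₃ ⟫ ⟩

  stage-partition : ∀ {S₁ S₂ S₃} → (∀ p → exactly-one (S₁ p) (S₂ p) (S₃ p) ≡ true) → IsPartition (stage S₁ S₂ S₃)
  stage-partition {S₁} {S₂} {S₃} one =
      ⟪⟫-∩-⊥ (λ p → proj₁ (spec p))
    , ⟪⟫-∩-⊥ (λ p → proj₁ (proj₂ (spec p)))
    , ⟪⟫-∩-⊥ (λ p → proj₁ (proj₂ (proj₂ (spec p))))
    , trans (cong (_∪ ⟪ S₃ ⟫) ⟪⟫-∪ᴾ) (⟪⟫-∪-⊤ (λ p → proj₂ (proj₂ (proj₂ (spec p)))))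
    where
    spec : ∀ p → S₁ p ∧ S₂ p ≡ false × S₁ p ∧ S₃ p ≡ false × S₂ p ∧ S₃ p ≡ false
                 × (S₁ p ∨ S₂ p) ∨ S₃ p ≡ true
    spec p = exactly-one-spec (one p)

  I-independent : Independent G ⟪ is I ⟫
  I-independent = ⟪⟫-independent {is I} outside-independent λ u → trans (part-I u)

  Y₁-independent : Independent G ⟪ is Y₁ ⟫
  Y₁-independent = ⟪⟫-independent {is Y₁} independent₁ λ u → trans (part-Y₁ u)

  Y₂-independent : Independent G ⟪ is Y₂ ⟫
  Y₂-independent = ⟪⟫-independent {is Y₂} independent₂ λ u → trans (part-Y₂ u)

  nothing-independent : Independent G ⟪ nothing ⟫
  nothing-independent = ⟪⟫-independent {nothing} independent₁ λ _ ()

  X-parts : Part → Bool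
  X-parts = is Y₁ ∪ᴾ (is Y₂ ∪ᴾ is D)

  part-X : ∀ u → x u ≡ X-parts (part u)
  part-X u = begin
    x u                   ≡⟨ not-involutive (x u) ⟨
    not (not (x u))       ≡⟨ cong not (part-I u) ⟩
    not (is I (part u))   ≡⟨ every-part {λ p → not (is I p) ≡ X-parts p} refl refl refl refl (part u) ⟩
    X-parts (part u)      ∎
    where open ≡-Reasoning

  count-parts-∪ : ∀ S S′ → (∀ p → S p ∧ S′ p ≡ false) →
    count ((S ∪ᴾ S′) ∘ part) ≡ count (S ∘ part) + count (S′ ∘ part)
  count-parts-∪ S S′ none = count-∨̇ λ u su → subst (λ α → α ∧ S′ (part u) ≡ false) su (none (part u))

  load-in-X : ∀ {S} → (∀ p → S p ≡ true → X-parts p ≡ true) → ∣ ⟪ S ⟫ ∣ ≤ count x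
  load-in-X {S} S⊆X = begin
    ∣ ⟪ S ⟫ ∣             ≡⟨ ∣⟪⟫∣ S ⟩
    count (S ∘ part)      ≤⟨ count-mono (λ u su → trans (part-X u) (S⊆X (part u) su)) ⟩
    count x               ∎
    where open ≤-Reasoning

  load-I∪D : ∣ ⟪ is I ∪ᴾ is D ⟫ ∣ ≤ count x
  load-I∪D = begin
    ∣ ⟪ is I ∪ᴾ is D ⟫ ∣                                   ≡⟨ ∣⟪⟫∣ (is I ∪ᴾ is D) ⟩
    count ((is I ∪ᴾ is D) ∘ part)                         ≡⟨ count-parts-∪ (is I) (is D) (every-part refl refl refl refl) ⟩
    count (is I ∘ part) + count (is D ∘ part)             ≡⟨ cong (_+ count (is D ∘ part)) (count-cong (sym ∘ part-I)) ⟩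
    count (not ∘ x) + count (is D ∘ part)                 ≤⟨ +-monoˡ-≤ _ outside≤pair ⟩
    count y₁ + count y₂ + count (is D ∘ part)             ≡⟨ +-assoc (count y₁) _ _ ⟩
    count y₁ + (count y₂ + count (is D ∘ part))
      ≡⟨ cong₂ (λ a b → a + (b + count (is D ∘ part))) (count-cong part-Y₁) (count-cong part-Y₂) ⟩
    count (is Y₁ ∘ part) + (count (is Y₂ ∘ part) + count (is D ∘ part))
      ≡⟨ cong (count (is Y₁ ∘ part) +_) (count-parts-∪ (is Y₂) (is D) (every-part refl refl refl refl)) ⟨
    count (is Y₁ ∘ part) + count ((is Y₂ ∪ᴾ is D) ∘ part)
      ≡⟨ count-parts-∪ (is Y₁) (is Y₂ ∪ᴾ is D) (every-part refl refl refl refl) ⟨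
    count (X-parts ∘ part)                                       ≡⟨ count-cong part-X ⟨
    count x                                                      ∎
    where open ≤-Reasoning

  trip : ℕ → Triple n
  trip 1 = stage (is I) X-parts nothing
  trip 2 = stage (is I) (is Y₂ ∪ᴾ is D) (is Y₁)
  trip 3 = stage (is Y₂) (is I ∪ᴾ is D) (is Y₁)
  trip 4 = stage (is Y₂) (is Y₁ ∪ᴾ is D) (is I)
  trip 5 = stage nothing X-parts (is I)
  trip _ = stage nothing nothing nothing

  feasible : FeasibleSchedule G (count x)
  feasible = 2 , trip , valid
    , ⟪⟫-∪-⊤ (every-part refl refl refl refl)
    , ⟪⟫-∪-⊤ (every-part refl refl refl refl)
    , even , odd
    where
    beyond : ∀ j → 5 < 2 * (3 + j)
    beyond j = *-monoʳ-≤ 2 (m≤m+n 3 j)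
    valid : ∀ k → 1 ≤ k → k ≤ 5 →
      IsPartition (trip k) × Independent G (L (trip k)) × Independent G (R (trip k)) × ∣ B (trip k) ∣ ≤ count x
    valid 1 _ _ = stage-partition (every-part refl refl refl refl) , I-independent , nothing-independent
                , load-in-X (λ _ in-X → in-X)
    valid 2 _ _ = stage-partition (every-part refl refl refl refl) , I-independent , Y₁-independent
                , load-in-X (every-part (λ ()) (λ ()) (λ _ → refl) (λ _ → refl))
    valid 3 _ _ = stage-partition (every-part refl refl refl refl) , Y₂-independent , Y₁-independent
                , load-I∪D
    valid 4 _ _ = stage-partition (every-part refl refl refl refl) , Y₂-independent , I-independent
                , load-in-X (every-part (λ ()) (λ _ → refl) (λ ()) (λ _ → refl))
    valid 5 _ _ = stage-partition (every-part refl refl refl refl) , nothing-independent , I-independent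
                , load-in-X (λ _ in-X → in-X)
    valid (suc (suc (suc (suc (suc (suc _)))))) _ (s≤s (s≤s (s≤s (s≤s (s≤s ())))))
    even : ∀ j → 1 ≤ j → 2 * j ≤ 5 →
      L (trip (2 * j)) ≡ L (trip (2 * j ∸ 1))
      × B (trip (2 * j)) ∪ R (trip (2 * j)) ≡ B (trip (2 * j ∸ 1)) ∪ R (trip (2 * j ∸ 1))
    even 1 _ _ = refl , ⟪⟫-∪ (every-part refl refl refl refl)
    even 2 _ _ = refl , ⟪⟫-∪ (every-part refl refl refl refl)
    even (suc (suc (suc j))) _ 2j≤5 = contradiction 2j≤5 (<⇒≱ (beyond j))
    odd : ∀ j → 1 ≤ j → suc (2 * j) ≤ 5 →
      R (trip (suc (2 * j))) ≡ R (trip (2 * j))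
      × B (trip (suc (2 * j))) ∪ L (trip (suc (2 * j))) ≡ B (trip (2 * j)) ∪ L (trip (2 * j))
    odd 1 _ _ = refl , ⟪⟫-∪ (every-part refl refl refl refl)
    odd 2 _ _ = refl , ⟪⟫-∪ (every-part refl refl refl refl)
    odd (suc (suc (suc j))) _ 2j+1≤5 = contradiction (≤-trans (n≤1+n _) 2j+1≤5) (<⇒≱ (beyond j))

class-one : {G : SimpleGraph n} (X : Subset n) → VertexCover G X → (∀ C → VertexCover G C → ∣ X ∣ ≤ ∣ C ∣) →
  1 ≤ ∣ X ∣ →
  ∀ {y₁ y₂} → IndependentPairIn G (lookup X) y₁ y₂ → count (not ∘ lookup X) ≤ count y₁ + count y₂ → ClassOne G
class-one {G = G} X cover minimal 1≤∣X∣ pair outside≤pair =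
  ∣ X ∣ , ((X , cover , refl) , minimal) , 1≤∣X∣ , feasible , lower-bound
  where
  feasible : FeasibleSchedule G ∣ X ∣
  feasible = subst (FeasibleSchedule G) (sym (∣∣≡count-lookup X))
    (Schedule.feasible (cover⇒independent-complement G cover) pair outside≤pair)
  lower-bound : ∀ b → 1 ≤ b → FeasibleSchedule G b → ∣ X ∣ ≤ b
  lower-bound b _ schedule with first-load-covers G schedule
  ... | C , C-cover , ∣C∣≤b = ≤-trans (minimal C C-cover) ∣C∣≤b

-- Exchanges in a maximum independent pair

module MaximumPair {G : SimpleGraph n} {x y₁ y₂ : Vector Bool n} (max : IsMaximumPairIn G x y₁ y₂) where

  open IsMaximumPairIn max
  open IndependentPairIn pair

  leftover : Vector Bool n
  leftover v = x v ∧ not (y₁ v ∨ y₂ v)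

  leftover-spec : ∀ {v} → leftover v ≡ true → x v ≡ true × y₁ v ≡ false × y₂ v ≡ false
  leftover-spec {v} lv with x v | y₁ v | y₂ v
  ... | true | false | false = refl , refl , refl
  leftover-spec () | false | _ | _
  leftover-spec () | true | true | _
  leftover-spec () | true | false | true

  leftover-has-neighbour : ∀ {v} → leftover v ≡ true → 1 ≤ degreeIn G y₁ v
  leftover-has-neighbour {v} lv with leftover-spec lv
  ... | xv , ¬y₁v , ¬y₂v = ≮⇒≥ λ degree<1 →
    <⇒≱ (≤-reflexive (cong (_+ count y₂) (sym (count-insert y₁ ¬y₁v))))
        (maximal (insert₁ G x pair xv ¬y₂v (no-neighbour G degree<1)))

  SoleNeighbour : Fin n → Fin n → Set
  SoleNeighbour v a₀ = ∀ u → y₁ u ≡ true → Adj G v u ≡ true → u ≡ a₀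

  isolated-from-rest : ∀ {v a₀} → SoleNeighbour v a₀ → ∀ u → (y₁ ∖｛ a₀ ｝) u ≡ true → Adj G v u ≡ false
  isolated-from-rest {v} {a₀} sole u u∈ = ¬-not λ edge → ∖｛｝-other y₁ a₀ u∈ (sole u (∖｛｝-⊆ y₁ a₀ u u∈) edge)

  module _ {a₀} (y₁a₀ : y₁ a₀ ≡ true) where

    rest : IndependentPairIn G x (y₁ ∖｛ a₀ ｝) y₂
    rest = shrink₁ G x (∖｛｝-⊆ y₁ a₀) pair

    sole-neighbour-has-neighbour₂ : ∀ {v} → leftover v ≡ true → SoleNeighbour v a₀ → 1 ≤ degreeIn G y₂ a₀
    sole-neighbour-has-neighbour₂ {v} lv sole with leftover-spec lv
    ... | xv , ¬y₁v , ¬y₂v = ≮⇒≥ λ degree<1 → <⇒≱ growth (maximal (moved degree<1))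
      where
      v≢a₀ : v ≢ a₀
      v≢a₀ refl = contradiction (trans (sym ¬y₁v) y₁a₀) λ ()
      moved : degreeIn G y₂ a₀ < 1 → IndependentPairIn G x ((y₁ ∖｛ a₀ ｝) ∨̇ ｛ v ｝) (y₂ ∨̇ ｛ a₀ ｝)
      moved degree<1 = insert₁ G x
        (swap-pair G x (insert₁ G x (swap-pair G x rest) (inside₁ a₀ y₁a₀) (∖｛｝-self y₁ a₀) (no-neighbour G degree<1)))
        xv (∨̇｛｝-outside y₂ ¬y₂v v≢a₀) (isolated-from-rest sole)
      growth : count y₁ + count y₂ < count ((y₁ ∖｛ a₀ ｝) ∨̇ ｛ v ｝) + count (y₂ ∨̇ ｛ a₀ ｝)
      growth = ≤-reflexive (sym (begin
        count ((y₁ ∖｛ a₀ ｝) ∨̇ ｛ v ｝) + count (y₂ ∨̇ ｛ a₀ ｝)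
          ≡⟨ cong₂ _+_ (count-replace y₁ y₁a₀ ¬y₁v) (count-insert y₂ (disjoint a₀ y₁a₀)) ⟩
        count y₁ + suc (count y₂)                              ≡⟨ +-suc (count y₁) (count y₂) ⟩
        suc (count y₁ + count y₂)                              ∎))
        where open ≡-Reasoning

    sole-neighbours-adjacent : ∀ {v₁ v₂} → v₂ ≢ v₁ →
      leftover v₁ ≡ true → SoleNeighbour v₁ a₀ → leftover v₂ ≡ true → SoleNeighbour v₂ a₀ → Adj G v₂ v₁ ≡ true
    sole-neighbours-adjacent {v₁} {v₂} v₂≢v₁ lv₁ sole₁ lv₂ sole₂ with leftover-spec lv₁ | leftover-spec lv₂
    ... | xv₁ , ¬y₁v₁ , ¬y₂v₁ | xv₂ , ¬y₁v₂ , ¬y₂v₂ = ¬-not λ nonadjacent → <⇒≱ growth (maximal (grown nonadjacent))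
      where
      grown : Adj G v₂ v₁ ≡ false → IndependentPairIn G x (((y₁ ∖｛ a₀ ｝) ∨̇ ｛ v₁ ｝) ∨̇ ｛ v₂ ｝) y₂
      grown nonadjacent = insert₁ G x (insert₁ G x rest xv₁ ¬y₂v₁ (isolated-from-rest sole₁)) xv₂ ¬y₂v₂
        λ u u∈ → [ isolated-from-rest sole₂ u
                 , (λ u=v₁ → subst (λ w → Adj G v₂ w ≡ false) (sym (｛｝-sound {v = v₁} {u} u=v₁)) nonadjacent) ]
                 (∨̇-elim (y₁ ∖｛ a₀ ｝) ｛ v₁ ｝ u∈)
      growth : count y₁ + count y₂ < count (((y₁ ∖｛ a₀ ｝) ∨̇ ｛ v₁ ｝) ∨̇ ｛ v₂ ｝) + count y₂
      growth = ≤-reflexive (cong (_+ count y₂) (sym (begin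
        count (((y₁ ∖｛ a₀ ｝) ∨̇ ｛ v₁ ｝) ∨̇ ｛ v₂ ｝)
          ≡⟨ count-insert ((y₁ ∖｛ a₀ ｝) ∨̇ ｛ v₁ ｝)
               (∨̇｛｝-outside (y₁ ∖｛ a₀ ｝) (∖｛｝-outside y₁ ¬y₁v₂) v₂≢v₁) ⟩
        suc (count ((y₁ ∖｛ a₀ ｝) ∨̇ ｛ v₁ ｝))       ≡⟨ cong suc (count-replace y₁ y₁a₀ ¬y₁v₁) ⟩
        suc (count y₁)                              ∎)))
        where open ≡-Reasoning

-- Regular graphs of degree at most five

-- m₁, m₂ count the neighbours of a leftover vertex in y₁, y₂ (both positive by maximality) and k those
-- in the leftover set; 2m₁ + 2m₂ + k ≥ 5 except in the tight case m₁ = m₂ = 1, k = 0.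
leftover-weight : ∀ δ m₁ m₂ k → (δ ≡ true → 1 ≤ m₁ × 1 ≤ m₂) →
  5 * ⟦ δ ⟧ ≤ ⟦ δ ∧ ((m₁ ≡ᵇ 1) ∧ ((m₂ ≡ᵇ 1) ∧ (k ≡ᵇ 0))) ⟧ + ⟦ δ ⟧ * (m₁ + (m₂ + (m₁ + (m₂ + k))))
leftover-weight false _ _ _ _ = z≤n
leftover-weight true m₁ m₂ k degrees with degrees refl
... | s≤s {n = a} _ , s≤s {n = b} _ =
  subst (λ t → 5 ≤ ⟦ (m₁ ≡ᵇ 1) ∧ ((m₂ ≡ᵇ 1) ∧ (k ≡ᵇ 0)) ⟧ + t)
        (sym (trans (*-identityˡ _) (reshape a b k)))
        (five≤ a b k)
  where
  reshape : ∀ a b s → suc a + (suc b + (suc a + (suc b + s))) ≡ 4 + (a + (b + (a + (b + s))))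
  reshape = solve-∀
  five≤ : ∀ a b s → 5 ≤ ⟦ (a ≡ᵇ 0) ∧ ((b ≡ᵇ 0) ∧ (s ≡ᵇ 0)) ⟧ + (4 + (a + (b + (a + (b + s)))))
  five≤ zero zero zero = ≤-refl
  five≤ zero zero (suc s) = s≤s (s≤s (s≤s (s≤s (s≤s z≤n))))
  five≤ zero (suc b) s = s≤s (s≤s (s≤s (s≤s (s≤s z≤n))))
  five≤ (suc a) b s = s≤s (s≤s (s≤s (s≤s (s≤s z≤n))))

module RegularGraph {G : SimpleGraph n} {r : ℕ} (regular : Regular r G) {x y₁ y₂ : Vector Bool n}
  (outside-independent : IndependentSet G (not ∘ x)) (max : IsMaximumPairIn G x y₁ y₂) where

  open IsMaximumPairIn max
  open IndependentPairIn pair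
  open MaximumPair max
  module Second = MaximumPair (swap-maximum G x max)

  x-partition : ∀ v → x v ≡ y₁ v ∨ (y₂ v ∨ leftover v)
  x-partition v = split (x v) (y₁ v) (y₂ v) (inside₁ v) (inside₂ v)
    where
    split : ∀ ξ α β → (α ≡ true → ξ ≡ true) → (β ≡ true → ξ ≡ true) → ξ ≡ α ∨ (β ∨ (ξ ∧ not (α ∨ β)))
    split true true _ _ _ = refl
    split true false true _ _ = refl
    split true false false _ _ = refl
    split false false false _ _ = refl
    split false true _ α⇒ξ _ = α⇒ξ refl
    split false false true _ β⇒ξ = β⇒ξ refl

  disjoint₁ : Disjointᵇ y₁ (y₂ ∨̇ leftover)
  disjoint₁ u y₁u rewrite disjoint u y₁u | y₁u = ∧-zeroʳ (x u)

  disjoint₂ : Disjointᵇ y₂ leftover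
  disjoint₂ u y₂u rewrite disjoint-sym disjoint u y₂u | y₂u = ∧-zeroʳ (x u)

  count-x : count x ≡ count y₁ + (count y₂ + count leftover)
  count-x = trans (count-cong x-partition) (trans (count-∨̇ disjoint₁) (cong (count y₁ +_) (count-∨̇ disjoint₂)))

  degreeIn-x : ∀ v → degreeIn G x v ≡ degreeIn G y₁ v + (degreeIn G y₂ v + degreeIn G leftover v)
  degreeIn-x v = trans (degreeIn-partition G x-partition disjoint₁ v)
                       (cong (degreeIn G y₁ v +_) (degreeIn-partition G (λ _ → refl) disjoint₂ v))

  edges-xʳ : ∀ p → edges G p x ≡ edges G p y₁ + (edges G p y₂ + edges G p leftover)
  edges-xʳ p = trans (edges-partitionʳ G x-partition disjoint₁ p)
                     (cong (edges G p y₁ +_) (edges-partitionʳ G (λ _ → refl) disjoint₂ p))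

  edges-xˡ : ∀ q → edges G x q ≡ edges G y₁ q + (edges G y₂ q + edges G leftover q)
  edges-xˡ q = trans (edges-partitionˡ G x-partition disjoint₁ q)
                     (cong (edges G y₁ q +_) (edges-partitionˡ G (λ _ → refl) disjoint₂ q))

  double-count : r * count x ≡ r * count (not ∘ x) + edges G x x
  double-count = begin
    r * count x                                 ≡⟨ edges-regular G regular x x ⟨
    edges G x (not ∘ x) + edges G x x           ≡⟨ cong (_+ edges G x x) (edges-sym G x (not ∘ x)) ⟩
    edges G (not ∘ x) x + edges G x x           ≡⟨ cong (_+ edges G x x) outside-edges ⟩
    r * count (not ∘ x) + edges G x x           ∎
    where
    open ≡-Reasoning
    outside-edges : edges G (not ∘ x) x ≡ r * count (not ∘ x)
    outside-edges = begin
      edges G (not ∘ x) x                                  ≡⟨ cong (_+ edges G (not ∘ x) x) no-inner-edges ⟨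
      edges G (not ∘ x) (not ∘ x) + edges G (not ∘ x) x    ≡⟨ edges-regular G regular (not ∘ x) x ⟩
      r * count (not ∘ x)                                  ∎
      where
      no-inner-edges : edges G (not ∘ x) (not ∘ x) ≡ 0
      no-inner-edges = edges-const G (λ v → independent⇒degreeIn≡0 G outside-independent)

  tight : Vector Bool n
  tight v = leftover v ∧ ((degreeIn G y₁ v ≡ᵇ 1) ∧ ((degreeIn G y₂ v ≡ᵇ 1) ∧ (degreeIn G leftover v ≡ᵇ 0)))

  tight-spec : ∀ {v} → tight v ≡ true → leftover v ≡ true × degreeIn G y₁ v ≡ 1 × degreeIn G leftover v ≡ 0
  tight-spec tv with ∧-true tv
  ... | lv , degrees with ∧-true degrees
  ...   | deg₁≡1 , rest = lv , ≡ᵇ-true⇒≡ deg₁≡1 , ≡ᵇ-true⇒≡ (proj₂ (∧-true rest))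

  tight-sole : ∀ {a₀ v} → y₁ a₀ ≡ true → Adj G a₀ v ≡ true → tight v ≡ true → SoleNeighbour v a₀
  tight-sole {a₀} {v} y₁a₀ edge tv u y₁u vu =
    count≤1⇒unique {p = λ w → Adj G v w ∧ y₁ w} (≤-reflexive (proj₁ (proj₂ (tight-spec tv))))
      (cong₂ _∧_ vu y₁u) (cong₂ _∧_ (trans (SimpleGraph.sym G v a₀) edge) y₁a₀)

  tight-neighbours-unique : ∀ {a₀ w w′} → y₁ a₀ ≡ true →
    Adj G a₀ w ∧ tight w ≡ true → Adj G a₀ w′ ∧ tight w′ ≡ true → w ≡ w′
  tight-neighbours-unique {a₀} {w} {w′} y₁a₀ a₀w∧tw a₀w′∧tw′ with ∧-true a₀w∧tw | ∧-true a₀w′∧tw′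
  ... | a₀w , tw | a₀w′ , tw′ with w ≟ w′
  ...   | yes w≡w′ = w≡w′
  ...   | no w≢w′ = contradiction (trans (sym adjacent) nonadjacent) λ ()
    where
    adjacent : Adj G w′ w ≡ true
    adjacent = sole-neighbours-adjacent y₁a₀ (w≢w′ ∘ sym)
      (proj₁ (tight-spec tw)) (tight-sole y₁a₀ a₀w tw) (proj₁ (tight-spec tw′)) (tight-sole y₁a₀ a₀w′ tw′)
    nonadjacent : Adj G w′ w ≡ false
    nonadjacent = no-neighbour G (≤-reflexive (cong suc (proj₂ (proj₂ (tight-spec tw′))))) w (proj₁ (tight-spec tw))

  tight-degree≤y₂-degree : ∀ {a₀} → y₁ a₀ ≡ true → degreeIn G tight a₀ ≤ degreeIn G y₂ a₀
  tight-degree≤y₂-degree {a₀} y₁a₀ with 1 ≤? degreeIn G tight a₀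
  ... | no ¬1≤ = ≤-trans (≤-pred (≰⇒> ¬1≤)) z≤n
  ... | yes 1≤ with count-witness {p = λ u → Adj G a₀ u ∧ tight u} 1≤
  ...   | v , a₀v∧tv with ∧-true a₀v∧tv
  ...     | a₀v , tv =
    ≤-trans at-most-one (sole-neighbour-has-neighbour₂ y₁a₀ (proj₁ (tight-spec tv)) (tight-sole y₁a₀ a₀v tv))
    where
    at-most-one : degreeIn G tight a₀ ≤ 1
    at-most-one = unique⇒count≤1 λ _ _ → tight-neighbours-unique y₁a₀

  leftover-weighted : 5 * count leftover ≤ count tight + (edges G leftover y₁ + (edges G leftover y₂ + edges G leftover x))
  leftover-weighted = begin
    5 * count leftover                                                               ≡⟨ *-distribˡ-sum {n} 5 _ ⟩
    ∑[ v < n ] (5 * ⟦ leftover v ⟧)                                                   ≤⟨ sum-mono-≤ per-vertex ⟩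
    ∑[ v < n ] (⟦ tight v ⟧ + ⟦ leftover v ⟧ * (deg y₁ v + (deg y₂ v + deg x v)))     ≡⟨ ∑-distrib-+ {n} _ _ ⟩
    count tight + ∑[ v < n ] (⟦ leftover v ⟧ * (deg y₁ v + (deg y₂ v + deg x v)))
      ≡⟨ cong (count tight +_) (trans (weighted-+ leftover _ _) (cong (edges G leftover y₁ +_) (weighted-+ leftover _ _))) ⟩
    count tight + (edges G leftover y₁ + (edges G leftover y₂ + edges G leftover x)) ∎
    where
    open ≤-Reasoning
    deg = degreeIn G
    per-vertex : ∀ v → 5 * ⟦ leftover v ⟧ ≤ ⟦ tight v ⟧ + ⟦ leftover v ⟧ * (deg y₁ v + (deg y₂ v + deg x v))
    per-vertex v = subst (λ t → 5 * ⟦ leftover v ⟧ ≤ ⟦ tight v ⟧ + ⟦ leftover v ⟧ * (deg y₁ v + (deg y₂ v + t)))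
      (sym (degreeIn-x v))
      (leftover-weight (leftover v) (deg y₁ v) (deg y₂ v) (deg leftover v)
        λ lv → leftover-has-neighbour lv
             , Second.leftover-has-neighbour (trans (cong (λ β → x v ∧ not β) (∨-comm (y₂ v) (y₁ v))) lv))

  leftover-edges≤ : count tight + (edges G leftover y₁ + (edges G leftover y₂ + edges G leftover x)) ≤ edges G x x
  leftover-edges≤ = begin
    count tight + (edges G leftover y₁ + (edges G leftover y₂ + edges G leftover x))
      ≡⟨ cong₂ (λ t e → t + (e + (edges G leftover y₂ + edges G leftover x))) tight-edges (edges-sym G leftover y₁) ⟩
    edges G y₁ tight + (edges G y₁ leftover + (edges G leftover y₂ + edges G leftover x))
      ≡⟨ cong (λ e → edges G y₁ tight + (edges G y₁ leftover + (e + edges G leftover x))) (edges-sym G leftover y₂) ⟩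
    edges G y₁ tight + (edges G y₁ leftover + (edges G y₂ leftover + edges G leftover x))
      ≤⟨ +-monoˡ-≤ _ (edges-mono G λ _ → tight-degree≤y₂-degree) ⟩
    edges G y₁ y₂ + (edges G y₁ leftover + (edges G y₂ leftover + edges G leftover x))
      ≡⟨ +-assoc (edges G y₁ y₂) _ _ ⟨
    (edges G y₁ y₂ + edges G y₁ leftover) + (edges G y₂ leftover + edges G leftover x)
      ≤⟨ +-mono-≤ inside-y₁ (+-monoˡ-≤ _ inside-y₂) ⟩
    edges G y₁ x + (edges G y₂ x + edges G leftover x)
      ≡⟨ edges-xˡ x ⟨
    edges G x x ∎
    where
    open ≤-Reasoning
    tight-edges : count tight ≡ edges G y₁ tight
    tight-edges = trans (sym (trans (edges-const G λ _ tv → proj₁ (proj₂ (tight-spec tv))) (*-identityˡ _)))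
                        (edges-sym G tight y₁)
    inside-y₁ : edges G y₁ y₂ + edges G y₁ leftover ≤ edges G y₁ x
    inside-y₁ = ≤-trans (m≤n+m _ (edges G y₁ y₁)) (≤-reflexive (sym (edges-xʳ y₁)))
    inside-y₂ : edges G y₂ leftover ≤ edges G y₂ x
    inside-y₂ = ≤-trans (m≤n+m _ (edges G y₂ y₁ + edges G y₂ y₂))
                        (≤-reflexive (trans (+-assoc (edges G y₂ y₁) _ _) (sym (edges-xʳ y₂))))

  outside≤pair : 1 ≤ r → r ≤ 5 → count (not ∘ x) ≤ count y₁ + count y₂
  outside≤pair 1≤r r≤5 = *-cancelˡ-≤ r {{>-nonZero 1≤r}} (+-cancelʳ-≤ (r * count leftover) _ _ (begin
    r * count (not ∘ x) + r * count leftover        ≤⟨ +-monoʳ-≤ _ (*-monoˡ-≤ (count leftover) r≤5) ⟩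
    r * count (not ∘ x) + 5 * count leftover        ≤⟨ +-monoʳ-≤ _ (≤-trans leftover-weighted leftover-edges≤) ⟩
    r * count (not ∘ x) + edges G x x               ≡⟨ double-count ⟨
    r * count x                                     ≡⟨ cong (r *_) (trans count-x (sym (+-assoc (count y₁) _ _))) ⟩
    r * (count y₁ + count y₂ + count leftover)      ≡⟨ *-distribˡ-+ r _ _ ⟩
    r * (count y₁ + count y₂) + r * count leftover  ∎))
    where open ≤-Reasoning

two-to-five-bounds : ∀ {r} → r ≡ 2 ⊎ r ≡ 3 ⊎ r ≡ 4 ⊎ r ≡ 5 → 1 ≤ r × r ≤ 5
two-to-five-bounds (inj₁ refl) = s≤s z≤n , s≤s (s≤s z≤n)
two-to-five-bounds (inj₂ (inj₁ refl)) = s≤s z≤n , s≤s (s≤s (s≤s z≤n))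
two-to-five-bounds (inj₂ (inj₂ (inj₁ refl))) = s≤s z≤n , s≤s (s≤s (s≤s (s≤s z≤n)))
two-to-five-bounds (inj₂ (inj₂ (inj₂ refl))) = s≤s z≤n , ≤-refl

theorem3p9 : ∀ (n : ℕ) (G : SimpleGraph n) (r : ℕ) → 1 ≤ n →
    (r ≡ 2 ⊎ r ≡ 3 ⊎ r ≡ 4 ⊎ r ≡ 5) → Regular r G → ClassOne G
theorem3p9 (suc n) G r _ r∈2…5 regular with two-to-five-bounds r∈2…5
... | 1≤r , r≤5
  with minimum-exists anySubset? (vertexCover? G) ∣_∣ (⊤ , λ u _ _ → inj₁ ∈⊤)
     | neighbour-exists G (subst (1 ≤_) (sym (regular zero)) 1≤r)
...   | X , cover , minimal | _ , edge with maximum-pair-exists G (lookup X)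
...     | _ , _ , max =
  class-one X cover minimal (cover-nonempty G cover edge) (IsMaximumPairIn.pair max)
    (RegularGraph.outside≤pair regular (cover⇒independent-complement G cover) max 1≤r r≤5)
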